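{- Let $G$ be a finite group with identity $e$ and let $H=\{H_1,\dots,H_m\}$ be a collection of subgroups of $G$ such that $|G|=|H_i||H_j|$ for all $i\ne j$ and $H$ is a partition of $G$. Then: (i) $H$ is a non-disjoint GPSEDF with $\lambda_{i,j}=1$ for all $i\ne j$ (a non-disjoint PSEDF when all $|H_i|$ are equal); (ii) $H'=\{H_1\setminus\{e\},\dots,H_m\setminus\{e\}\}$ is a classical GEDF (a classical EDF when all $|H_i|$ are equal) which is not a classical GSEDF.
   Context: A family of subgroups of $G$ is a partition of $G$ if every non-identity element of $G$ belongs to exactly one subgroup in the family. For subsets $A,B$ of a multiplicatively written group $G$, $\Delta(A,B)$ denotes the multiset $\{ab^{ -1}:a\in A,b\in B\}$ (one entry per pair); multiset unions count multiplicity. For a set $S$ and $\lambda\in\mathbb{N}$, $\lambda S$ is the multiset of $\lambda$ copies of $S$. Let $|G|=v$. Non-disjoint $(v,m,k_1,\dots,k_m)$-GPSEDF: sets $A_1,\dots,A_m$ in $G$, $|A_i|=k_i$, with $\Delta(A_i,A_j)=\lambda_{i,j}G$, $\lambda_{i,j}=k_ik_j/v$, for all $i\ne j$. Non-disjoint $(v,m,k,\lambda)$-PSEDF: the case of $m>1$ sets all of size $k$ with $\Delta(A_i,A_j)=\lambda G$ for all $i\neq j$. Classical $(v,m;k_1,\dots,k_m;\lambda)$-GEDF: pairwise disjoint sets $A_1,\dots,A_m$ with $|A_i|=k_i$ and $\bigcup_{i\ne j}\Delta(A_i,A_j)=\lambda(G\setminus\{e\})$ (union over ordered pairs). A classical EDF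 is a classical GEDF with all $k_i$ equal (and $m>1$). Classical $(v,m;k_1,\dots,k_m;\lambda_1,\dots,\lambda_m)$-GSEDF: pairwise disjoint sets with $|A_i|=k_i$ and, for each $i$, $\bigcup_{j\ne i}\Delta(A_i,A_j)=\lambda_i(G\setminus\{e\})$. -}

module Defs where

open import Data.Nat using (ℕ; zero; suc; _+_; _*_; _<_)
open import Data.Fin using (Fin)
open import Data.Fin.Properties using (_≟_)
open import Data.Fin.Subset using (Subset; _∈_; ∣_∣; _-_)
open import Data.Fin.Subset.Properties using (_∈?_)
open import Data.Nat.ListAction using (sum)
open import Data.List as List using (List; allFin; length; filter; cartesianProduct)
open import Data.Product using (Σ; ∃; _×_; _,_; proj₁; proj₂)
open import Relation.Binary.PropositionalEquality using (_≡_; _≢_)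
open import Relation.Nullary using (¬_; yes; no)
open import Relation.Nullary.Decidable using (_×-dec_)
open import Algebra.Structures using (IsGroup)

-- A finite group of order v, presented on the carrier Fin v
-- (every finite group is isomorphic to one of this form).
record FinGroup (v : ℕ) : Set where
  field
    _∙_     : Fin v → Fin v → Fin v
    ε       : Fin v
    _⁻¹     : Fin v → Fin v
    isGroup : IsGroup _≡_ _∙_ ε _⁻¹

module _ {v : ℕ} (G : FinGroup v) where
  open FinGroup G

  IsSubgroup : Subset v → Set
  IsSubgroup H = (ε ∈ H)
               × (∀ a b → a ∈ H → b ∈ H → (a ∙ b) ∈ H)
               × (∀ a → a ∈ H → (a ⁻¹) ∈ H)

  -- multiplicity of g in the multiset Δ(A,B) = {a b⁻¹ : a ∈ A, b ∈ B}
  Δ : Subset v → Subset v → Fin v → ℕ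
  Δ A B g = length (filter (λ p → (proj₁ p ∈? A) ×-dec ((proj₂ p ∈? B) ×-dec ((proj₁ p ∙ (proj₂ p ⁻¹)) ≟ g)))
                           (cartesianProduct (allFin v) (allFin v)))

sumFin : (m : ℕ) → (Fin m → ℕ) → ℕ
sumFin m f = sum (List.map f (allFin m))

sumOthers : {m : ℕ} → Fin m → (Fin m → ℕ) → ℕ
sumOthers {m} i f = sumFin m (λ j → h j (i ≟ j))
  where
  open import Relation.Nullary using (Dec)
  h : ∀ j → Dec (i ≡ j) → ℕ
  h j (yes _) = 0
  h j (no _)  = f j

module _ {v : ℕ} (G : FinGroup v) where
  open FinGroup G

  IsPartition : {m : ℕ} → (Fin m → Subset v) → Set
  IsPartition {m} H = ∀ g → g ≢ ε → (∃ λ i → g ∈ H i) × (∀ i j → g ∈ H i → g ∈ H j → i ≡ j)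

  PairwiseDisjoint : {m : ℕ} → (Fin m → Subset v) → Set
  PairwiseDisjoint {m} A = ∀ i j → i ≢ j → ∀ g → g ∈ A i → ¬ (g ∈ A j)

  IsλGminusE : (Fin v → ℕ) → ℕ → Set
  IsλGminusE M λ' = ∀ g → (g ≡ ε → M g ≡ 0) × (g ≢ ε → M g ≡ λ')

  IsNonDisjointGPSEDF : {m : ℕ} → (Fin m → Subset v) → (Fin m → Fin m → ℕ) → Set
  IsNonDisjointGPSEDF {m} A λ' = ∀ i j → i ≢ j →
    (λ' i j * v ≡ ∣ A i ∣ * ∣ A j ∣) × (∀ g → Δ G (A i) (A j) g ≡ λ' i j)

  IsNonDisjointPSEDF : {m : ℕ} → (Fin m → Subset v) → ℕ → ℕ → Set
  IsNonDisjointPSEDF {m} A k λ' = (1 < m) × (∀ i → ∣ A i ∣ ≡ k)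
    × (∀ i j → i ≢ j → ∀ g → Δ G (A i) (A j) g ≡ λ')

  IsGEDF : {m : ℕ} → (Fin m → Subset v) → ℕ → Set
  IsGEDF {m} A λ' = PairwiseDisjoint A
    × IsλGminusE (λ g → sumFin m (λ i → sumOthers i (λ j → Δ G (A i) (A j) g))) λ'

  IsEDF : {m : ℕ} → (Fin m → Subset v) → ℕ → ℕ → Set
  IsEDF {m} A k λ' = (1 < m) × (∀ i → ∣ A i ∣ ≡ k) × IsGEDF A λ'

  IsGSEDF : {m : ℕ} → (Fin m → Subset v) → (Fin m → ℕ) → Set
  IsGSEDF {m} A λs = PairwiseDisjoint A
    × (∀ i → IsλGminusE (λ g → sumOthers i (λ j → Δ G (A i) (A j) g)) (λs i))

-- For i ≠ j the subgroups H i and H j meet only in ε, so (a , b) ↦ a b⁻¹ is injective on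
-- H i × H j; since |H i| |H j| = |G| it is a bijection, i.e. Δ(H i, H j) = G.  After removing ε,
-- the equation a b⁻¹ = g has its (unique) solution exactly when g lies in neither H i nor H j.
-- A non-identity g lies in exactly one H p, so it is counted once for every ordered pair of
-- distinct indices avoiding p, that is (m - 1)(m - 2) times.  The partial sums over j ≠ i are
-- not constant on G ∖ {ε}: the one for i vanishes on H i ∖ {ε} but not at a b⁻¹ with b ∈ H j.
module Submission where

open import Defs
open import Data.Nat using (ℕ; _*_; _≤_)
open import Data.Fin using (Fin)
open import Data.Fin.Subset using (Subset; _∈_; ∣_∣; _-_)
open import Data.Product using (Σ; ∃; ∃₂; _×_)
open import Relation.Binary.PropositionalEquality using (_≡_; _≢_)
open import Relation.Nullary using (¬_)

open import Algebra.Bundles using (Group)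
import Algebra.Properties.Group as GroupProperties
open import Algebra.Structures using (IsGroup)
open import Data.Bool.Base using (true; false; if_then_else_)
open import Data.Fin.Base using (zero; suc; punchIn; punchOut)
open import Data.Fin.Properties
  using (_≟_; punchInᵢ≢i; punchIn-injective; punchIn-punchOut)
open import Data.Fin.Subset using (_∉_; _─_; _⊆_; ⁅_⁆; inside; outside)
open import Data.Fin.Subset.Properties
  using (_∈?_; p─q⊆p; p─⊥≡p; x∈p∧x≢y⇒x∈p-y; x∉⁅y⁆⇒x≢y)
open import Data.List.Base as List using ([]; _∷_; filter; length; cartesianProduct)
open import Data.List.Properties using (map-++; map-∘)
import Data.Nat.ListAction as ListAction
open import Data.Nat.ListAction.Properties using (sum-++)
open import Data.Nat.Base using (zero; suc; _+_; _∸_; _<_; z≤n; s≤s; z<s)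
open import Data.Nat.Properties
  using (+-*-semiring; +-identityʳ; +-assoc; +-comm; *-zeroʳ; *-identityʳ; +-mono-≤; +-monoʳ-≤;
         +-cancelʳ-≡; +-cancelʳ-≤; m≤m+n; ≤-antisym; ≤-trans; ≤-reflexive; ≮⇒≥; n≤0⇒n≡0;
         m+n∸n≡m; suc-injective; _<?_; module ≤-Reasoning)
open import Data.Product using (_,_; proj₁; proj₂)
open import Data.Vec.Base using ([]; _∷_; here; there)
open import Data.Vec.Functional using (removeAt)
open import Function.Base using (_∘_; id)
open import Relation.Binary.PropositionalEquality
  using (refl; sym; trans; cong; cong₂; subst; ≢-sym; module ≡-Reasoning)
open import Relation.Nullary using (Dec; yes; no; does; contradiction)
open import Relation.Nullary.Decidable using (_×-dec_)
open import Relation.Unary using (Decidable)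

open import Algebra.Properties.Semiring.Sum +-*-semiring
  using (sum; sum-syntax; sum-cong-≗; sum-remove; sum-replicate-zero; ∑-comm;
         *-distribˡ-sum; *-distribʳ-sum)

𝟙 : ∀ {p} {P : Set p} → Dec P → ℕ
𝟙 P? = if does P? then 1 else 0

module _ {p} {P : Set p} where

  𝟙-true : (P? : Dec P) → P → 𝟙 P? ≡ 1
  𝟙-true (yes _) x = refl
  𝟙-true (no ¬x) x = contradiction x ¬x

  𝟙-false : (P? : Dec P) → ¬ P → 𝟙 P? ≡ 0
  𝟙-false (yes x) ¬x = contradiction x ¬x
  𝟙-false (no _)  ¬x = refl

  0<𝟙⇒ : (P? : Dec P) → 0 < 𝟙 P? → P
  0<𝟙⇒ (yes x) 0<𝟙 = x

∑-const : ∀ n c → ∑[ i < n ] c ≡ n * c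
∑-const zero    c = refl
∑-const (suc n) c = cong (c +_) (∑-const n c)

∑-zero : ∀ {n} {f : Fin n → ℕ} → (∀ i → f i ≡ 0) → sum f ≡ 0
∑-zero {n} f≡0 = trans (sum-cong-≗ f≡0) (sum-replicate-zero n)

∑-const-except : ∀ {n} (f : Fin n → ℕ) (i : Fin n) {c} →
                 (∀ j → j ≢ i → f j ≡ c) → sum f + c ≡ f i + n * c
∑-const-except {suc n} f i {c} off = begin
  sum f + c                     ≡⟨ cong (_+ c) (sum-remove {i = i} f) ⟩
  f i + sum (removeAt f i) + c  ≡⟨ cong (λ s → f i + s + c) removed ⟩
  f i + n * c + c               ≡⟨ +-assoc (f i) (n * c) c ⟩
  f i + (n * c + c)             ≡⟨ cong (f i +_) (+-comm (n * c) c) ⟩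
  f i + suc n * c               ∎
  where
  open ≡-Reasoning
  removed : sum (removeAt f i) ≡ n * c
  removed = trans (sum-cong-≗ (λ j → off (punchIn i j) (punchInᵢ≢i i j))) (∑-const n c)

∑-single : ∀ {n} (f : Fin n → ℕ) (i : Fin n) → (∀ j → j ≢ i → f j ≡ 0) → sum f ≡ f i
∑-single {n} f i off = begin
  sum f          ≡⟨ sym (+-identityʳ (sum f)) ⟩
  sum f + 0      ≡⟨ ∑-const-except f i off ⟩
  f i + n * 0    ≡⟨ cong (f i +_) (*-zeroʳ n) ⟩
  f i + 0        ≡⟨ +-identityʳ (f i) ⟩
  f i            ∎
  where open ≡-Reasoning

0<∑⇒∃0< : ∀ {n} (f : Fin n → ℕ) → 0 < sum f → ∃ λ i → 0 < f i
0<∑⇒∃0< {suc n} f 0<∑ with 0 <? f zero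
... | yes 0<f₀ = zero , 0<f₀
... | no  0≮f₀ with 0<∑⇒∃0< (f ∘ suc) (subst (λ x → 0 < x + sum (f ∘ suc)) (n≤0⇒n≡0 (≮⇒≥ 0≮f₀)) 0<∑)
...   | i , 0<fᵢ = suc i , 0<fᵢ

term≤∑ : ∀ {n} (f : Fin n → ℕ) (i : Fin n) → f i ≤ sum f
term≤∑ {suc n} f i = subst (f i ≤_) (sym (sum-remove {i = i} f)) (m≤m+n (f i) _)

∑-≤ : ∀ {n} (f : Fin n → ℕ) {c} → (∀ i → f i ≤ c) → sum f ≤ n * c
∑-≤ {zero}  f bound = z≤n
∑-≤ {suc n} f bound = +-mono-≤ (bound zero) (∑-≤ (f ∘ suc) (bound ∘ suc))

∑≡size⇒≡1 : ∀ {n} (f : Fin n → ℕ) → (∀ i → f i ≤ 1) → sum f ≡ n → ∀ i → f i ≡ 1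
∑≡size⇒≡1 {suc n} f ≤1 ∑≡ i = ≤-antisym (≤1 i) (+-cancelʳ-≤ n 1 (f i) (begin
  suc n                        ≡⟨ sym ∑≡ ⟩
  sum f                        ≡⟨ sum-remove {i = i} f ⟩
  f i + sum (removeAt f i)     ≤⟨ +-monoʳ-≤ (f i) (∑-≤ (removeAt f i) (≤1 ∘ punchIn i)) ⟩
  f i + n * 1                  ≡⟨ cong (f i +_) (*-identityʳ n) ⟩
  f i + n                      ∎))
  where open ≤-Reasoning

∑-𝟙-×-dec : ∀ {n p q} {P : Set p} {Q : Fin n → Set q} (P? : Dec P) (Q? : ∀ i → Dec (Q i)) →
            ∑[ i < n ] 𝟙 (P? ×-dec Q? i) ≡ 𝟙 P? * ∑[ i < n ] 𝟙 (Q? i)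
∑-𝟙-×-dec {n} P? Q? with P?
... | yes _ = sym (+-identityʳ _)
... | no  _ = sum-replicate-zero n

∑-𝟙-≟ : ∀ {n} (x : Fin n) → ∑[ y < n ] 𝟙 (x ≟ y) ≡ 1
∑-𝟙-≟ x = trans (∑-single _ x (λ y y≢x → 𝟙-false (x ≟ y) (≢-sym y≢x))) (𝟙-true (x ≟ x) refl)

module _ {m n p} {P : Fin m × Fin n → Set p} (P? : Decidable P) where

  ∑∑-𝟙-unique : ∀ {a b} → (∀ {x y} → P (x , y) → x ≡ a × y ≡ b) → P (a , b) →
                ∑[ x < m ] ∑[ y < n ] 𝟙 (P? (x , y)) ≡ 1
  ∑∑-𝟙-unique {a} {b} unique Pab = begin
    ∑[ x < m ] ∑[ y < n ] 𝟙 (P? (x , y))  ≡⟨ ∑-single (λ x → ∑[ y < n ] 𝟙 (P? (x , y))) a row-a ⟩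
    ∑[ y < n ] 𝟙 (P? (a , y))              ≡⟨ ∑-single _ b (λ y y≢b → 𝟙-false (P? _) (y≢b ∘ proj₂ ∘ unique)) ⟩
    𝟙 (P? (a , b))                         ≡⟨ 𝟙-true (P? _) Pab ⟩
    1                                      ∎
    where
    open ≡-Reasoning
    row-a : ∀ x → x ≢ a → ∑[ y < n ] 𝟙 (P? (x , y)) ≡ 0
    row-a x x≢a = ∑-zero {n} (λ y → 𝟙-false (P? _) (x≢a ∘ proj₁ ∘ unique))

  0<∑∑-𝟙⇒∃ : 0 < ∑[ x < m ] ∑[ y < n ] 𝟙 (P? (x , y)) → ∃ P
  0<∑∑-𝟙⇒∃ 0<∑∑ with 0<∑⇒∃0< _ 0<∑∑
  ... | x , 0<∑ with 0<∑⇒∃0< _ 0<∑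
  ...   | y , 0<𝟙 = (x , y) , 0<𝟙⇒ (P? _) 0<𝟙

sum-map-tabulate : ∀ {a} {A : Set a} {n} (f : A → ℕ) (g : Fin n → A) →
                   ListAction.sum (List.map f (List.tabulate g)) ≡ ∑[ i < n ] f (g i)
sum-map-tabulate {n = zero}  f g = refl
sum-map-tabulate {n = suc n} f g = cong (f (g zero) +_) (sum-map-tabulate f (g ∘ suc))

sumFin≡∑ : ∀ {n} (f : Fin n → ℕ) → sumFin n f ≡ sum f
sumFin≡∑ f = sum-map-tabulate f id

length-filter≡sum-𝟙 : ∀ {a p} {A : Set a} {P : A → Set p} (P? : Decidable P) xs →
                      length (filter P? xs) ≡ ListAction.sum (List.map (𝟙 ∘ P?) xs)
length-filter≡sum-𝟙 P? []       = refl
length-filter≡sum-𝟙 P? (x ∷ xs) with does (P? x)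
... | true  = cong suc (length-filter≡sum-𝟙 P? xs)
... | false = length-filter≡sum-𝟙 P? xs

sum-map-cartesianProduct : ∀ {a b} {A : Set a} {B : Set b} (f : A × B → ℕ) xs ys →
  ListAction.sum (List.map f (cartesianProduct xs ys))
    ≡ ListAction.sum (List.map (λ x → ListAction.sum (List.map (λ y → f (x , y)) ys)) xs)
sum-map-cartesianProduct f []       ys = refl
sum-map-cartesianProduct f (x ∷ xs) ys = begin
  ListAction.sum (List.map f (List.map (x ,_) ys List.++ cartesianProduct xs ys))
    ≡⟨ cong ListAction.sum (map-++ f (List.map (x ,_) ys) _) ⟩
  ListAction.sum (List.map f (List.map (x ,_) ys) List.++ List.map f (cartesianProduct xs ys))
    ≡⟨ sum-++ (List.map f (List.map (x ,_) ys)) _ ⟩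
  ListAction.sum (List.map f (List.map (x ,_) ys)) + ListAction.sum (List.map f (cartesianProduct xs ys))
    ≡⟨ cong₂ _+_ (cong ListAction.sum (sym (map-∘ ys))) (sum-map-cartesianProduct f xs ys) ⟩
  ListAction.sum (List.map (λ y → f (x , y)) ys) + _
    ∎
  where open ≡-Reasoning

length-filter-allFin² : ∀ {m n p} {P : Fin m × Fin n → Set p} (P? : Decidable P) →
  length (filter P? (cartesianProduct (List.allFin m) (List.allFin n)))
    ≡ ∑[ x < m ] ∑[ y < n ] 𝟙 (P? (x , y))
length-filter-allFin² {m} {n} P? = begin
  length (filter P? (cartesianProduct (List.allFin m) (List.allFin n)))
    ≡⟨ length-filter≡sum-𝟙 P? (cartesianProduct (List.allFin m) (List.allFin n)) ⟩
  ListAction.sum (List.map (𝟙 ∘ P?) (cartesianProduct (List.allFin m) (List.allFin n)))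
    ≡⟨ sum-map-cartesianProduct (𝟙 ∘ P?) (List.allFin m) (List.allFin n) ⟩
  sumFin m (λ x → sumFin n (λ y → 𝟙 (P? (x , y))))
    ≡⟨ sumFin≡∑ (λ x → sumFin n (λ y → 𝟙 (P? (x , y)))) ⟩
  ∑[ x < m ] sumFin n (λ y → 𝟙 (P? (x , y)))
    ≡⟨ sum-cong-≗ (λ x → sumFin≡∑ (λ y → 𝟙 (P? (x , y)))) ⟩
  ∑[ x < m ] ∑[ y < n ] 𝟙 (P? (x , y))
    ∎
  where open ≡-Reasoning

-- The summand of sumOthers i f is local to its where-block (it vanishes at i and is f
-- elsewhere); unification names it so that it can be evaluated by cases on i ≟ j.
private
  othersSummand : ∀ {m} (i : Fin m) (f : Fin m → ℕ) →
                  Σ (Fin m → ℕ) λ F → sumOthers i f ≡ sumFin m F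
  othersSummand i f = _ , refl

  othersSummand-at : ∀ {m} (i : Fin m) (f : Fin m → ℕ) → proj₁ (othersSummand i f) i ≡ 0
  othersSummand-at i f with i ≟ i
  ... | yes _   = refl
  ... | no  i≢i = contradiction refl i≢i

  othersSummand-off : ∀ {m} {i j : Fin m} (f : Fin m → ℕ) → j ≢ i → proj₁ (othersSummand i f) j ≡ f j
  othersSummand-off {i = i} {j} f j≢i with i ≟ j
  ... | yes i≡j = contradiction (sym i≡j) j≢i
  ... | no  _   = refl

sumOthers≡∑-removeAt : ∀ {n} (i : Fin (suc n)) (f : Fin (suc n) → ℕ) →
                       sumOthers i f ≡ sum (removeAt f i)
sumOthers≡∑-removeAt i f = begin
  sumOthers i f            ≡⟨ sumFin≡∑ F ⟩
  sum F                    ≡⟨ sum-remove {i = i} F ⟩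
  F i + sum (removeAt F i) ≡⟨ cong₂ _+_ (othersSummand-at i f) (sum-cong-≗ (λ j → othersSummand-off f (punchInᵢ≢i i j))) ⟩
  sum (removeAt f i)       ∎
  where
  open ≡-Reasoning
  F = proj₁ (othersSummand i f)

sumOthers-zero : ∀ {m} (i : Fin m) (f : Fin m → ℕ) → (∀ j → j ≢ i → f j ≡ 0) → sumOthers i f ≡ 0
sumOthers-zero {suc n} i f off =
  trans (sumOthers≡∑-removeAt i f) (∑-zero (λ j → off (punchIn i j) (punchInᵢ≢i i j)))

term≤sumOthers : ∀ {m} {i j : Fin m} (f : Fin m → ℕ) → j ≢ i → f j ≤ sumOthers i f
term≤sumOthers {suc n} {i} {j} f j≢i = begin
  f j                                 ≡⟨ cong f (sym (punchIn-punchOut i≢j)) ⟩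
  removeAt f i (punchOut i≢j)         ≤⟨ term≤∑ (removeAt f i) (punchOut i≢j) ⟩
  sum (removeAt f i)                  ≡⟨ sym (sumOthers≡∑-removeAt i f) ⟩
  sumOthers i f                       ∎
  where
  open ≤-Reasoning
  i≢j = ≢-sym j≢i

sumOthers-const-except : ∀ {n} (i p : Fin (suc n)) (f : Fin (suc n) → ℕ) {c} → p ≢ i →
                         (∀ j → j ≢ i → j ≢ p → f j ≡ c) → sumOthers i f + c ≡ f p + n * c
sumOthers-const-except {n} i p f {c} p≢i off = begin
  sumOthers i f + c                      ≡⟨ cong (_+ c) (sumOthers≡∑-removeAt i f) ⟩
  sum (removeAt f i) + c                 ≡⟨ ∑-const-except (removeAt f i) (punchOut i≢p) off′ ⟩
  f (punchIn i (punchOut i≢p)) + n * c   ≡⟨ cong (λ j → f j + n * c) (punchIn-punchOut i≢p) ⟩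
  f p + n * c                            ∎
  where
  open ≡-Reasoning
  i≢p = ≢-sym p≢i
  off′ : ∀ j → j ≢ punchOut i≢p → f (punchIn i j) ≡ c
  off′ j j≢ = off (punchIn i j) (punchInᵢ≢i i j)
    (λ eq → j≢ (punchIn-injective i j _ (trans eq (sym (punchIn-punchOut i≢p)))))

ordered-pairs-avoiding : ∀ {m} (p : Fin m) (W : Fin m → Fin m → ℕ) →
  (∀ {i j} → j ≢ i → i ≢ p → j ≢ p → W i j ≡ 1) →
  (∀ {j} → j ≢ p → W p j ≡ 0) →
  (∀ {i} → i ≢ p → W i p ≡ 0) →
  ∑[ i < m ] sumOthers i (W i) ≡ (m ∸ 1) * (m ∸ 2)
ordered-pairs-avoiding {suc n} p W avoiding from-p to-p = +-cancelʳ-≡ (n ∸ 1) _ _ (begin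
  sum row + (n ∸ 1)            ≡⟨ ∑-const-except row p row≡ ⟩
  row p + suc n * (n ∸ 1)      ≡⟨ cong (_+ suc n * (n ∸ 1)) (sumOthers-zero p (W p) (λ j → from-p)) ⟩
  (n ∸ 1) + n * (n ∸ 1)        ≡⟨ +-comm (n ∸ 1) (n * (n ∸ 1)) ⟩
  n * (n ∸ 1) + (n ∸ 1)        ∎)
  where
  open ≡-Reasoning
  row : Fin (suc n) → ℕ
  row i = sumOthers i (W i)
  row≡ : ∀ i → i ≢ p → row i ≡ n ∸ 1
  row≡ i i≢p = begin
    row i                ≡⟨ sym (m+n∸n≡m (row i) 1) ⟩
    row i + 1 ∸ 1        ≡⟨ cong (_∸ 1) (sumOthers-const-except i p (W i) (≢-sym i≢p) (λ j j≢i j≢p → avoiding j≢i i≢p j≢p)) ⟩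
    W i p + n * 1 ∸ 1    ≡⟨ cong (λ x → x + n * 1 ∸ 1) (to-p i≢p) ⟩
    n * 1 ∸ 1            ≡⟨ cong (_∸ 1) (*-identityʳ n) ⟩
    n ∸ 1                ∎

∣p∣≡∑𝟙 : ∀ {n} (p : Subset n) → ∣ p ∣ ≡ ∑[ x < n ] 𝟙 (x ∈? p)
∣p∣≡∑𝟙 []            = refl
∣p∣≡∑𝟙 (inside  ∷ p) = cong suc (∣p∣≡∑𝟙 p)
∣p∣≡∑𝟙 (outside ∷ p) = ∣p∣≡∑𝟙 p

x∈p─q⇒x∉q : ∀ {n} {x : Fin n} (p q : Subset n) → x ∈ p ─ q → x ∉ q
x∈p─q⇒x∉q (inside ∷ p) (outside ∷ q) here         ()
x∈p─q⇒x∉q (_      ∷ p) (_       ∷ q) (there x∈p─q) (there x∈q) = x∈p─q⇒x∉q p q x∈p─q x∈q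

x∈p-y⇒x∈p∧x≢y : ∀ {n} {x y : Fin n} {p : Subset n} → x ∈ p - y → x ∈ p × x ≢ y
x∈p-y⇒x∈p∧x≢y {y = y} {p} x∈p-y =
  p─q⊆p p ⁅ y ⁆ x∈p-y , x∉⁅y⁆⇒x≢y (x∈p─q⇒x∉q p ⁅ y ⁆ x∈p-y)

x∈p⇒1+∣p-x∣≡∣p∣ : ∀ {n} {x : Fin n} {p : Subset n} → x ∈ p → suc ∣ p - x ∣ ≡ ∣ p ∣
x∈p⇒1+∣p-x∣≡∣p∣ {p = inside  ∷ p} here          = cong (suc ∘ ∣_∣) (p─⊥≡p p)
x∈p⇒1+∣p-x∣≡∣p∣ {p = inside  ∷ p} (there x∈p) = cong suc (x∈p⇒1+∣p-x∣≡∣p∣ x∈p)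
x∈p⇒1+∣p-x∣≡∣p∣ {p = outside ∷ p} (there x∈p) = x∈p⇒1+∣p-x∣≡∣p∣ x∈p

toGroup : ∀ {v} → FinGroup v → Group _ _
toGroup G = record { isGroup = FinGroup.isGroup G }

module _ {v : ℕ} (G : FinGroup v) where
  open FinGroup G
  open IsGroup isGroup using (assoc; _//_; _\\_)
  open GroupProperties (toGroup G)
    using (⁻¹-involutive; inverseʳ-unique; \\-leftDividesʳ; //-rightDividesˡ)

  QuotientInjective : Subset v → Subset v → Set
  QuotientInjective A B = ∀ {a a′ b b′} → a ∈ A → a′ ∈ A → b ∈ B → b′ ∈ B →
                          a // b ≡ a′ // b′ → a ≡ a′ × b ≡ b′

  QuotientInjective-⊆ : ∀ {A A′ B B′} → A′ ⊆ A → B′ ⊆ B →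
                        QuotientInjective A B → QuotientInjective A′ B′
  QuotientInjective-⊆ A′⊆A B′⊆B inj a∈ a′∈ b∈ b′∈ =
    inj (A′⊆A a∈) (A′⊆A a′∈) (B′⊆B b∈) (B′⊆B b′∈)

  x\\y≡ε⇒x≡y : ∀ x y → x \\ y ≡ ε → x ≡ y
  x\\y≡ε⇒x≡y x y eq = sym (trans (inverseʳ-unique (x ⁻¹) y eq) (⁻¹-involutive x))

  //≡//⇒\\≡\\ : ∀ {a a′ b b′} → a // b ≡ a′ // b′ → a \\ a′ ≡ b \\ b′
  //≡//⇒\\≡\\ {a} {a′} {b} {b′} eq = begin
    a \\ a′                  ≡⟨ cong (a \\_) (sym (//-rightDividesˡ b′ a′)) ⟩
    a \\ ((a′ // b′) ∙ b′)   ≡⟨ cong (λ x → a \\ (x ∙ b′)) (sym eq) ⟩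
    a \\ ((a // b) ∙ b′)     ≡⟨ sym (assoc (a ⁻¹) (a // b) b′) ⟩
    (a \\ (a // b)) ∙ b′     ≡⟨ cong (_∙ b′) (\\-leftDividesʳ a (b ⁻¹)) ⟩
    b \\ b′                  ∎
    where open ≡-Reasoning

  module Subgroup {H : Subset v} (H≤G : IsSubgroup G H) where

    ε∈H : ε ∈ H
    ε∈H = proj₁ H≤G

    ∙-closed : ∀ {a b} → a ∈ H → b ∈ H → a ∙ b ∈ H
    ∙-closed = proj₁ (proj₂ H≤G) _ _

    ⁻¹-closed : ∀ {a} → a ∈ H → a ⁻¹ ∈ H
    ⁻¹-closed = proj₂ (proj₂ H≤G) _

    //-closed : ∀ {a b} → a ∈ H → b ∈ H → a // b ∈ H
    //-closed a∈H b∈H = ∙-closed a∈H (⁻¹-closed b∈H)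

    \\-closed : ∀ {a b} → a ∈ H → b ∈ H → a \\ b ∈ H
    \\-closed a∈H b∈H = ∙-closed (⁻¹-closed a∈H) b∈H

    x//y∈H∧y∈H⇒x∈H : ∀ {x y} → x // y ∈ H → y ∈ H → x ∈ H
    x//y∈H∧y∈H⇒x∈H {x} {y} x//y∈H y∈H =
      subst (_∈ H) (//-rightDividesˡ y x) (∙-closed x//y∈H y∈H)

    x//y∈H∧x∈H⇒y∈H : ∀ {x y} → x // y ∈ H → x ∈ H → y ∈ H
    x//y∈H∧x∈H⇒y∈H {x} {y} x//y∈H x∈H = subst (_∈ H) (⁻¹-involutive y)
      (⁻¹-closed (subst (_∈ H) (\\-leftDividesʳ x (y ⁻¹)) (\\-closed x∈H x//y∈H)))

  trivial-∩⇒QuotientInjective : ∀ {H K} → IsSubgroup G H → IsSubgroup G K →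
    (∀ {x} → x ∈ H → x ∈ K → x ≡ ε) → QuotientInjective H K
  trivial-∩⇒QuotientInjective H≤G K≤G trivial a∈ a′∈ b∈ b′∈ eq =
    x\\y≡ε⇒x≡y _ _ (trivial a\\a′∈H (subst (_∈ _) (sym shared) b\\b′∈K)) ,
    x\\y≡ε⇒x≡y _ _ (trivial (subst (_∈ _) shared a\\a′∈H) b\\b′∈K)
    where
    shared = //≡//⇒\\≡\\ eq
    a\\a′∈H = Subgroup.\\-closed H≤G a∈ a′∈
    b\\b′∈K = Subgroup.\\-closed K≤G b∈ b′∈

  module _ (A B : Subset v) where

    solves? : ∀ g → Decidable λ (ab : Fin v × Fin v) → proj₁ ab ∈ A × proj₂ ab ∈ B × proj₁ ab // proj₂ ab ≡ g
    solves? g (a , b) = (a ∈? A) ×-dec ((b ∈? B) ×-dec (a // b ≟ g))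

    Δ≡∑∑ : ∀ g → Δ G A B g ≡ ∑[ a < v ] ∑[ b < v ] 𝟙 (solves? g (a , b))
    Δ≡∑∑ g = length-filter-allFin² (solves? g)

    0<Δ⇒quotient : ∀ {g} → 0 < Δ G A B g → ∃₂ λ a b → a ∈ A × b ∈ B × a // b ≡ g
    0<Δ⇒quotient {g} 0<Δ with 0<∑∑-𝟙⇒∃ (solves? g) (subst (0 <_) (Δ≡∑∑ g) 0<Δ)
    ... | (a , b) , a∈A , b∈B , a//b≡g = a , b , a∈A , b∈B , a//b≡g

    Δ-absent : ∀ {g} → (∀ {a b} → a ∈ A → b ∈ B → a // b ≢ g) → Δ G A B g ≡ 0
    Δ-absent absent = n≤0⇒n≡0 (≮⇒≥ λ 0<Δ → let a , b , a∈A , b∈B , a//b≡g = 0<Δ⇒quotient 0<Δ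
                                          in absent a∈A b∈B a//b≡g)

    Δ-unique : QuotientInjective A B → ∀ {a b} → a ∈ A → b ∈ B → Δ G A B (a // b) ≡ 1
    Δ-unique inj {a} {b} a∈A b∈B = trans (Δ≡∑∑ (a // b))
      (∑∑-𝟙-unique (solves? (a // b)) (λ (x∈A , y∈B , eq) → inj x∈A a∈A y∈B b∈B eq) (a∈A , b∈B , refl))

    Δ≤1 : QuotientInjective A B → ∀ g → Δ G A B g ≤ 1
    Δ≤1 inj g with 0 <? Δ G A B g
    ... | no  0≮Δ = ≤-trans (≮⇒≥ 0≮Δ) z≤n
    ... | yes 0<Δ with 0<Δ⇒quotient 0<Δ
    ...   | a , b , a∈A , b∈B , refl = ≤-reflexive (Δ-unique inj a∈A b∈B)

    ∑Δ≡∣A∣*∣B∣ : ∑[ g < v ] Δ G A B g ≡ ∣ A ∣ * ∣ B ∣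
    ∑Δ≡∣A∣*∣B∣ = begin
      ∑[ g < v ] Δ G A B g                                     ≡⟨ sum-cong-≗ Δ≡∑∑ ⟩
      ∑[ g < v ] ∑[ a < v ] ∑[ b < v ] solves a b g            ≡⟨ ∑-comm (λ g a → ∑[ b < v ] solves a b g) ⟩
      ∑[ a < v ] ∑[ g < v ] ∑[ b < v ] solves a b g            ≡⟨ sum-cong-≗ (λ a → ∑-comm (λ g b → solves a b g)) ⟩
      ∑[ a < v ] ∑[ b < v ] ∑[ g < v ] solves a b g            ≡⟨ sum-cong-≗ (λ a → sum-cong-≗ (∑-solves a)) ⟩
      ∑[ a < v ] ∑[ b < v ] (𝟙 (a ∈? A) * 𝟙 (b ∈? B))         ≡⟨ sum-cong-≗ (λ a → sym (*-distribˡ-sum (𝟙 (a ∈? A)) (λ b → 𝟙 (b ∈? B)))) ⟩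
      ∑[ a < v ] (𝟙 (a ∈? A) * ∑[ b < v ] 𝟙 (b ∈? B))         ≡⟨ sym (*-distribʳ-sum (∑[ b < v ] 𝟙 (b ∈? B)) (λ a → 𝟙 (a ∈? A))) ⟩
      (∑[ a < v ] 𝟙 (a ∈? A)) * (∑[ b < v ] 𝟙 (b ∈? B))       ≡⟨ sym (cong₂ _*_ (∣p∣≡∑𝟙 A) (∣p∣≡∑𝟙 B)) ⟩
      ∣ A ∣ * ∣ B ∣                                            ∎
      where
      open ≡-Reasoning
      solves : Fin v → Fin v → Fin v → ℕ
      solves a b g = 𝟙 (solves? g (a , b))
      ∑-solves : ∀ a b → ∑[ g < v ] solves a b g ≡ 𝟙 (a ∈? A) * 𝟙 (b ∈? B)
      ∑-solves a b = begin
        ∑[ g < v ] solves a b g                                   ≡⟨ ∑-𝟙-×-dec (a ∈? A) (λ g → (b ∈? B) ×-dec (a // b ≟ g)) ⟩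
        𝟙 (a ∈? A) * ∑[ g < v ] 𝟙 ((b ∈? B) ×-dec (a // b ≟ g))  ≡⟨ cong (𝟙 (a ∈? A) *_) (∑-𝟙-×-dec (b ∈? B) (a // b ≟_)) ⟩
        𝟙 (a ∈? A) * (𝟙 (b ∈? B) * ∑[ g < v ] 𝟙 (a // b ≟ g))    ≡⟨ cong (λ s → 𝟙 (a ∈? A) * (𝟙 (b ∈? B) * s)) (∑-𝟙-≟ (a // b)) ⟩
        𝟙 (a ∈? A) * (𝟙 (b ∈? B) * 1)                             ≡⟨ cong (𝟙 (a ∈? A) *_) (*-identityʳ _) ⟩
        𝟙 (a ∈? A) * 𝟙 (b ∈? B)                                   ∎

    -- Pigeonhole: the v fibres of (a , b) ↦ a // b on A × B hold at most one point each
    -- and |A| |B| = v points in total.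
    Δ≡1 : QuotientInjective A B → v ≡ ∣ A ∣ * ∣ B ∣ → ∀ g → Δ G A B g ≡ 1
    Δ≡1 inj v≡ = ∑≡size⇒≡1 (Δ G A B) (Δ≤1 inj) (trans ∑Δ≡∣A∣*∣B∣ (sym v≡))

module Partition {v : ℕ} (G : FinGroup v) {m : ℕ} {H : Fin m → Subset v}
  (H≤G : ∀ i → IsSubgroup G (H i)) (partition : IsPartition G H) where
  open FinGroup G
  open IsGroup isGroup using (_//_)
  open GroupProperties (toGroup G) using (x∙y⁻¹≈ε⇒x≈y)
  open module Sub {i} = Subgroup G (H≤G i)

  H-∩-trivial : ∀ {i j x} → i ≢ j → x ∈ H i → x ∈ H j → x ≡ ε
  H-∩-trivial {i} {j} {x} i≢j x∈Hi x∈Hj with x ≟ ε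
  ... | yes x≡ε = x≡ε
  ... | no  x≢ε = contradiction (proj₂ (partition x x≢ε) i j x∈Hi x∈Hj) i≢j

  H-quotientInjective : ∀ {i j} → i ≢ j → QuotientInjective G (H i) (H j)
  H-quotientInjective i≢j = trivial-∩⇒QuotientInjective G (H≤G _) (H≤G _) (H-∩-trivial i≢j)

  punctured-quotientInjective : ∀ {i j} → i ≢ j → QuotientInjective G (H i - ε) (H j - ε)
  punctured-quotientInjective i≢j =
    QuotientInjective-⊆ G (p─q⊆p _ _) (p─q⊆p _ _) (H-quotientInjective i≢j)

  punctured-disjoint : PairwiseDisjoint G (λ i → H i - ε)
  punctured-disjoint i j i≢j g g∈Hi-ε g∈Hj-ε =
    let g∈Hi , g≢ε = x∈p-y⇒x∈p∧x≢y g∈Hi-ε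
    in g≢ε (H-∩-trivial i≢j g∈Hi (proj₁ (x∈p-y⇒x∈p∧x≢y g∈Hj-ε)))

  punctured-size : ∀ {i j} → ∣ H i ∣ ≡ ∣ H j ∣ → ∣ H i - ε ∣ ≡ ∣ H j - ε ∣
  punctured-size eq = suc-injective
    (trans (x∈p⇒1+∣p-x∣≡∣p∣ ε∈H) (trans eq (sym (x∈p⇒1+∣p-x∣≡∣p∣ ε∈H))))

  Δ-punctured-∈ˡ : ∀ {i j g} → i ≢ j → g ∈ H i → Δ G (H i - ε) (H j - ε) g ≡ 0
  Δ-punctured-∈ˡ i≢j g∈Hi = Δ-absent G _ _ λ a∈Hi-ε b∈Hj-ε a//b≡g →
    let b∈Hj , b≢ε = x∈p-y⇒x∈p∧x≢y b∈Hj-ε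
        a∈Hi = proj₁ (x∈p-y⇒x∈p∧x≢y a∈Hi-ε)
    in b≢ε (H-∩-trivial i≢j (x//y∈H∧x∈H⇒y∈H (subst (_∈ _) (sym a//b≡g) g∈Hi) a∈Hi) b∈Hj)

  Δ-punctured-∈ʳ : ∀ {i j g} → i ≢ j → g ∈ H j → Δ G (H i - ε) (H j - ε) g ≡ 0
  Δ-punctured-∈ʳ i≢j g∈Hj = Δ-absent G _ _ λ a∈Hi-ε b∈Hj-ε a//b≡g →
    let a∈Hi , a≢ε = x∈p-y⇒x∈p∧x≢y a∈Hi-ε
        b∈Hj = proj₁ (x∈p-y⇒x∈p∧x≢y b∈Hj-ε)
    in a≢ε (H-∩-trivial i≢j a∈Hi (x//y∈H∧y∈H⇒x∈H (subst (_∈ _) (sym a//b≡g) g∈Hj) b∈Hj))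

  punctured-not-GSEDF : ∀ {i j} → i ≢ j →
    (∃ λ a → a ∈ H i × a ≢ ε) → (∃ λ b → b ∈ H j × b ≢ ε) →
    ¬ (∃ λ (ls : Fin m → ℕ) → IsGSEDF G (λ i → H i - ε) ls)
  punctured-not-GSEDF {i} {j} i≢j (a , a∈Hi , a≢ε) (b , b∈Hj , b≢ε) (ls , _ , gsedf) =
    contradiction 1≤0 λ ()
    where
    open ≤-Reasoning
    row : Fin v → ℕ
    row g = sumOthers i (λ k → Δ G (H i - ε) (H k - ε) g)
    a//b≢ε : a // b ≢ ε
    a//b≢ε eq = a≢ε (H-∩-trivial i≢j a∈Hi (subst (_∈ H j) (sym (x∙y⁻¹≈ε⇒x≈y a b eq)) b∈Hj))
    1≤0 : 1 ≤ 0
    1≤0 = begin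
      1                                 ≡⟨ sym (Δ-unique G _ _ (punctured-quotientInjective i≢j)
                                                 (x∈p∧x≢y⇒x∈p-y a∈Hi a≢ε) (x∈p∧x≢y⇒x∈p-y b∈Hj b≢ε)) ⟩
      Δ G (H i - ε) (H j - ε) (a // b)  ≤⟨ term≤sumOthers (λ k → Δ G (H i - ε) (H k - ε) (a // b)) (≢-sym i≢j) ⟩
      row (a // b)                      ≡⟨ proj₂ (gsedf i (a // b)) a//b≢ε ⟩
      ls i                              ≡⟨ sym (proj₂ (gsedf i a) a≢ε) ⟩
      row a                             ≡⟨ sumOthers-zero i _ (λ k k≢i → Δ-punctured-∈ˡ (≢-sym k≢i) a∈Hi) ⟩
      0                                 ∎

  module _ (order : ∀ i j → i ≢ j → v ≡ ∣ H i ∣ * ∣ H j ∣) where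

    Δ-H≡1 : ∀ {i j} → i ≢ j → ∀ g → Δ G (H i) (H j) g ≡ 1
    Δ-H≡1 i≢j = Δ≡1 G _ _ (H-quotientInjective i≢j) (order _ _ i≢j)

    Δ-punctured-∉ : ∀ {i j g} → i ≢ j → g ∉ H i → g ∉ H j → Δ G (H i - ε) (H j - ε) g ≡ 1
    Δ-punctured-∉ {i} {j} {g} i≢j g∉Hi g∉Hj
      with 0<Δ⇒quotient G (H i) (H j) (subst (0 <_) (sym (Δ-H≡1 i≢j g)) z<s)
    ... | a , b , a∈Hi , b∈Hj , refl =
      Δ-unique G _ _ (punctured-quotientInjective i≢j) (x∈p∧x≢y⇒x∈p-y a∈Hi a≢ε) (x∈p∧x≢y⇒x∈p-y b∈Hj b≢ε)
      where
      a≢ε : a ≢ ε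
      a≢ε refl = g∉Hj (//-closed ε∈H b∈Hj)
      b≢ε : b ≢ ε
      b≢ε refl = g∉Hi (//-closed a∈Hi ε∈H)

    punctured-isGEDF : IsGEDF G (λ i → H i - ε) ((m ∸ 1) * (m ∸ 2))
    punctured-isGEDF = punctured-disjoint , λ g → at-ε g , off-ε g
      where
      W : Fin v → Fin m → Fin m → ℕ
      W g i j = Δ G (H i - ε) (H j - ε) g

      at-ε : ∀ g → g ≡ ε → sumFin m (λ i → sumOthers i (W g i)) ≡ 0
      at-ε g refl = trans (sumFin≡∑ (λ i → sumOthers i (W g i)))
        (∑-zero {m} (λ i → sumOthers-zero i (W ε i) (λ j j≢i → Δ-punctured-∈ˡ (≢-sym j≢i) ε∈H)))

      off-ε : ∀ g → g ≢ ε → sumFin m (λ i → sumOthers i (W g i)) ≡ (m ∸ 1) * (m ∸ 2)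
      off-ε g g≢ε = trans (sumFin≡∑ (λ i → sumOthers i (W g i))) (ordered-pairs-avoiding p (W g) avoiding
        (λ j≢p → Δ-punctured-∈ˡ (≢-sym j≢p) g∈Hp) (λ i≢p → Δ-punctured-∈ʳ i≢p g∈Hp))
        where
        p = proj₁ (proj₁ (partition g g≢ε))
        g∈Hp = proj₂ (proj₁ (partition g g≢ε))
        g∉H : ∀ {i} → i ≢ p → g ∉ H i
        g∉H i≢p g∈Hi = i≢p (proj₂ (partition g g≢ε) _ _ g∈Hi g∈Hp)
        avoiding : ∀ {i j} → j ≢ i → i ≢ p → j ≢ p → W g i j ≡ 1
        avoiding j≢i i≢p j≢p = Δ-punctured-∉ (≢-sym j≢i) (g∉H i≢p) (g∉H j≢p)

theorem4p12 : {v : ℕ} (G : FinGroup v) (m : ℕ) (H : Fin m → Subset v)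
    → 2 ≤ m
    → (∀ i → IsSubgroup G (H i))
    → (∀ i → ∃ λ g → (g ∈ H i) × (g ≢ FinGroup.ε G))
    → (∀ i j → i ≢ j → v ≡ ∣ H i ∣ * ∣ H j ∣)
    → IsPartition G H
    → (IsNonDisjointGPSEDF G H (λ _ _ → 1)
        × ((∀ i j → ∣ H i ∣ ≡ ∣ H j ∣) → ∃ λ k → IsNonDisjointPSEDF G H k 1))
      × ((∃ λ l → IsGEDF G (λ i → H i - FinGroup.ε G) l)
        × ((∀ i j → ∣ H i ∣ ≡ ∣ H j ∣) → ∃₂ λ k l → IsEDF G (λ i → H i - FinGroup.ε G) k l)
        × ¬ (∃ λ (ls : Fin m → ℕ) → IsGSEDF G (λ i → H i - FinGroup.ε G) ls))
theorem4p12 {v} G (suc (suc _)) H 2≤m@(s≤s (s≤s z≤n)) H≤G nontrivial order partition =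
    ( (λ i j i≢j → trans (+-identityʳ v) (order i j i≢j) , Δ-H≡1 order i≢j)
    , λ same → ∣ H zero ∣ , 2≤m , (λ i → same i zero) , λ i j i≢j → Δ-H≡1 order i≢j )
  , ( (_ , punctured-isGEDF order)
    , (λ same → _ , _ , 2≤m , (λ i → punctured-size (same i zero)) , punctured-isGEDF order)
    , punctured-not-GSEDF {zero} {suc zero} (λ ()) (nontrivial zero) (nontrivial (suc zero)) )
  where open Partition G H≤G partition
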